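{- Let $G$ be a bridgeless cubic graph without any odd covering and let $H$ be a connected bipartite cubic graph. Let $u\in V(G)$ with $N(u)=\{u_1,u_2,u_3\}$ and $v\in V(H)$ with $N(v)=\{v_1,v_2,v_3\}$, and let $G\otimes H$ be the graph obtained from $(G-u)\cup(H-v)$ by adding the edges $u_1v_1,u_2v_2,u_3v_3$. Then $G\otimes H$ has no odd covering.
   Context: An odd covering of a cubic graph $G$ is a finite list (repetitions allowed) of perfect matchings of $G$ such that every edge of $G$ is contained in an odd number of members of the list. -}

module Defs where

open import Data.Bool using (Bool; true; false; if_then_else_; T; not)
open import Data.Nat using (ℕ; zero; suc; _+_; _%_)
open import Data.Fin using (Fin)
open import Data.List using (List; []; _∷_; length; map; allFin; mapMaybe; _++_; lookup)
open import Data.Nat.ListAction using (sum)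
open import Data.Maybe using (Maybe; just; nothing)
open import Data.Product using (Σ; ∃; _×_; _,_; proj₁; proj₂)
open import Data.Sum using (_⊎_; inj₁; inj₂)
open import Relation.Binary.PropositionalEquality using (_≡_; _≢_)
open import Relation.Binary.Definitions using (DecidableEquality)
open import Relation.Binary.Construct.Closure.ReflexiveTransitive using (Star)
open import Relation.Nullary using (¬_; yes; no; does)
open import Relation.Nullary.Decidable using (False; fromWitnessFalse)
open import Function.Bundles using (_⇔_)

-- Edges: a finite list of (unordered) pairs of endpoints; an edge is
-- identified by its position in the list, so parallel edges are allowed.

record Graph : Set₁ where
  field
    V     : Set
    _≟_   : DecidableEquality V
    edges : List (V × V)

  Edge : Set
  Edge = Fin (length edges)

  ends : Edge → V × V
  ends e = lookup edges e

  -- number of ends of the edge (a , b) at vertex x (a loop counts twice)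
  inc : V → V × V → ℕ
  inc x (a , b) = (if does (a ≟ x) then 1 else 0) + (if does (b ≟ x) then 1 else 0)

  degIn : (Edge → Bool) → V → ℕ
  degIn S x = sum (map (λ e → if S e then inc x (ends e) else 0) (allFin (length edges)))

  degree : V → ℕ
  degree = degIn (λ _ → true)

  AdjAvoiding : Maybe Edge → V → V → Set
  AdjAvoiding f x y = ∃ λ e → (f ≢ just e) × (ends e ≡ (x , y) ⊎ ends e ≡ (y , x))

  Adj : V → V → Set
  Adj = AdjAvoiding nothing

open Graph public

Cubic : Graph → Set
Cubic G = ∀ x → degree G x ≡ 3

Connected : Graph → Set
Connected G = ∀ x y → Star (Adj G) x y

IsBridge : (G : Graph) → Edge G → Set
IsBridge G e = ¬ Star (AdjAvoiding G (just e)) (proj₁ (ends G e)) (proj₂ (ends G e))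

Bridgeless : Graph → Set
Bridgeless G = ∀ e → ¬ IsBridge G e

Bipartite : Graph → Set
Bipartite G = ∃ λ (c : V G → Bool) → ∀ e → c (proj₁ (ends G e)) ≢ c (proj₂ (ends G e))

IsPerfectMatching : (G : Graph) → (Edge G → Bool) → Set
IsPerfectMatching G M = ∀ x → degIn G M x ≡ 1

PerfectMatching : Graph → Set
PerfectMatching G = Σ (Edge G → Bool) (IsPerfectMatching G)

Odd : ℕ → Set
Odd n = n % 2 ≡ 1

multiplicity : (G : Graph) → List (PerfectMatching G) → Edge G → ℕ
multiplicity G []            e = 0
multiplicity G ((M , _) ∷ Ms) e = (if M e then 1 else 0) + multiplicity G Ms e

IsOddCovering : (G : Graph) → List (PerfectMatching G) → Set
IsOddCovering G Ms = ∀ e → Odd (multiplicity G Ms e)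

HasOddCovering : Graph → Set
HasOddCovering G = ∃ λ Ms → IsOddCovering G Ms

NeighbourhoodIs : (G : Graph) → V G → V G → V G → V G → Set
NeighbourhoodIs G x y₁ y₂ y₃ =
  (y₁ ≢ y₂) × (y₁ ≢ y₃) × (y₂ ≢ y₃) ×
  (∀ y → Adj G x y ⇔ (y ≡ y₁ ⊎ y ≡ y₂ ⊎ y ≡ y₃))

-- vertices of G - u
Punct : (G : Graph) → V G → Set
Punct G u = Σ (V G) (λ x → False (_≟_ G x u))

private
  False-irr : ∀ {b : Bool} (p q : T (not b)) → p ≡ q
  False-irr {false} _ _ = Relation.Binary.PropositionalEquality.refl

Punct-≟ : (G : Graph) (u : V G) → DecidableEquality (Punct G u)
Punct-≟ G u (x , p) (y , q) with _≟_ G x y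
... | yes Relation.Binary.PropositionalEquality.refl
      with False-irr p q
...   | Relation.Binary.PropositionalEquality.refl = yes Relation.Binary.PropositionalEquality.refl
Punct-≟ G u (x , p) (y , q) | no x≢y =
  no λ { Relation.Binary.PropositionalEquality.refl → x≢y Relation.Binary.PropositionalEquality.refl }

restrictEdge : (G : Graph) (u : V G) → V G × V G → Maybe (Punct G u × Punct G u)
restrictEdge G u (a , b) with _≟_ G a u | _≟_ G b u
... | no a≢u | no b≢u = just ((a , fromWitnessFalse a≢u) , (b , fromWitnessFalse b≢u))
... | _      | _      = nothing

deleteEdges : (G : Graph) (u : V G) → List (Punct G u × Punct G u)
deleteEdges G u = mapMaybe (restrictEdge G u) (edges G)

⊎-≟ : {A B : Set} → DecidableEquality A → DecidableEquality B → DecidableEquality (A ⊎ B)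
⊎-≟ dA dB (inj₁ a) (inj₁ a') with dA a a'
... | yes Relation.Binary.PropositionalEquality.refl = yes Relation.Binary.PropositionalEquality.refl
... | no ne = no λ { Relation.Binary.PropositionalEquality.refl → ne Relation.Binary.PropositionalEquality.refl }
⊎-≟ dA dB (inj₁ a) (inj₂ b) = no λ ()
⊎-≟ dA dB (inj₂ b) (inj₁ a) = no λ ()
⊎-≟ dA dB (inj₂ b) (inj₂ b') with dB b b'
... | yes Relation.Binary.PropositionalEquality.refl = yes Relation.Binary.PropositionalEquality.refl
... | no ne = no λ { Relation.Binary.PropositionalEquality.refl → ne Relation.Binary.PropositionalEquality.refl }

join : (G H : Graph) (u : V G) (u₁ u₂ u₃ : Punct G u)
       (v : V H) (v₁ v₂ v₃ : Punct H v) → Graph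
join G H u u₁ u₂ u₃ v v₁ v₂ v₃ = record
  { V     = Punct G u ⊎ Punct H v
  ; _≟_   = ⊎-≟ (Punct-≟ G u) (Punct-≟ H v)
  ; edges = map (λ { (a , b) → (inj₁ a , inj₁ b) }) (deleteEdges G u)
         ++ map (λ { (a , b) → (inj₂ a , inj₂ b) }) (deleteEdges H v)
         ++ (inj₁ u₁ , inj₂ v₁) ∷ (inj₁ u₂ , inj₂ v₂) ∷ (inj₁ u₃ , inj₂ v₃) ∷ []
  }

module Submission where

-- Let M be a perfect matching of J = G ⊗ H and let K be the number of
-- cut edges uᵢvᵢ in M.  Seen from H, M covers every vertex of H - v once, by
-- an edge of H - v or by a cut edge, while v is "covered by itself".  The cut
-- edges end in the colour class B of H opposite to v (the class A of v).
-- Since H is cubic and bipartite, the classes balance: counting over edge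
-- ends, the defect 1 at v ∈ A must equal the defect K on B, so K = 1.  Hence
-- M projects to a perfect matching of G: edges of G - u keep their status and
-- the edge uuᵢ takes the status of uᵢvᵢ.  Every edge of G inherits its
-- status from a partner edge of J, so an odd covering of J projects to an
-- odd covering of G, which does not exist.

open import Defs
open import Data.Bool using (Bool; true; false; if_then_else_; not)
import Data.Bool as Bool
open import Data.Bool.Properties using (not-¬; ¬-not; not-involutive; T-irrelevant)
open import Data.Nat using (ℕ; zero; suc; _+_; _*_; _≤_; z≤n)
open import Data.Nat.Properties
  using (+-*-semiring; +-commutativeSemigroup; +-assoc; *-comm; *-zeroʳ; *-identityʳ; *-identityˡ; +-identityʳ;
         *-distribˡ-+; *-distribʳ-+; +-cancelˡ-≡; *-cancelˡ-≡; ≤-trans; m≤m+n; m≤n+m; +-mono-≤;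
         suc-injective; ≤⇒≯)
open import Data.Nat.ListAction using (sum)
open import Data.List using (List; []; _∷_; length; map; allFin; tabulate; mapMaybe; _++_; lookup)
open import Data.List.Properties using (map-tabulate)
open import Data.List.Membership.Propositional using (_∈_)
open import Data.List.Relation.Unary.Any using (here; there)
open import Data.List.Relation.Unary.All using (All; []; _∷_)
import Data.List.Relation.Unary.All as All
open import Data.Fin using (Fin; zero; suc)
import Data.Fin.Properties as Fin
open import Data.Maybe using (Maybe; just; nothing)
open import Data.Product using (∃; _×_; _,_; proj₁; proj₂)
open import Data.Sum using (_⊎_; inj₁; inj₂; [_,_]′)
import Data.Sum as Sum
open import Data.Sum.Properties using (inj₁-injective; inj₂-injective)
open import Data.Empty using (⊥-elim)
open import Function.Bundles using (Equivalence)
open import Relation.Nullary using (¬_; Dec; yes; no; does)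
open import Relation.Nullary.Decidable using (dec-true; dec-false; toWitnessFalse; fromWitnessFalse)
open import Relation.Binary.Definitions using (DecidableEquality)
open import Relation.Binary.PropositionalEquality
  using (_≡_; _≢_; refl; sym; trans; cong; cong₂; subst; module ≡-Reasoning)
open import Algebra.Properties.CommutativeSemigroup +-commutativeSemigroup
  using (interchange; x∙yz≈y∙xz; xy∙z≈xz∙y)
open import Data.Nat.Solver using (module +-*-Solver)
open +-*-Solver using (solve; _:+_; _:*_; _:=_)
open import Algebra.Properties.Semiring.Sum +-*-semiring
  using (sum-syntax; ∑-distrib-+; ∑-comm; sum-cong-≗; *-distribˡ-sum; sum-replicate-zero)
  renaming (sum to ∑)

open ≡-Reasoning

-- Iverson bracket, and `b ⊙ n`: the quantity n counted only when b holds
-- (this is how degIn weights an edge by its membership in an edge set).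
⟦_⟧ : Bool → ℕ
⟦ b ⟧ = if b then 1 else 0

_⊙_ : Bool → ℕ → ℕ
b ⊙ n = if b then n else 0

infixr 7 _⊙_

⊙-zero : ∀ b → b ⊙ 0 ≡ 0
⊙-zero true  = refl
⊙-zero false = refl

∑-⊙-zero : ∀ n (b : Fin n → Bool) → ∑[ i < n ] (b i ⊙ 0) ≡ 0
∑-⊙-zero n b = trans (sum-cong-≗ (λ i → ⊙-zero (b i))) (sum-replicate-zero n)

⊙-+ : ∀ b m n → b ⊙ (m + n) ≡ b ⊙ m + b ⊙ n
⊙-+ true  m n = refl
⊙-+ false m n = refl

*-⊙ : ∀ k b n → k * (b ⊙ n) ≡ b ⊙ (k * n)
*-⊙ k true  n = refl
*-⊙ k false n = *-zeroʳ k

⊙-∑ : ∀ n b (F : Fin n → ℕ) → b ⊙ ∑[ i < n ] F i ≡ ∑[ i < n ] (b ⊙ F i)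
⊙-∑ n true  F = refl
⊙-∑ n false F = sym (sum-replicate-zero n)

sum-allFin : ∀ n (F : Fin n → ℕ) → sum (map F (allFin n)) ≡ ∑[ i < n ] F i
sum-allFin n F = trans (cong sum (map-tabulate (λ i → i) F)) (sum-tabulate n F)
  where
  sum-tabulate : ∀ n (F : Fin n → ℕ) → sum (tabulate F) ≡ ∑[ i < n ] F i
  sum-tabulate zero    F = refl
  sum-tabulate (suc n) F = cong (F zero +_) (sum-tabulate n (λ i → F (suc i)))

δ : {A : Set} → DecidableEquality A → A → A → ℕ
δ _≟_ x y = ⟦ does (x ≟ y) ⟧

does-⇔ : {P Q : Set} (p : Dec P) (q : Dec Q) → (P → Q) → (Q → P) → does p ≡ does q
does-⇔ (yes p) (yes q) f g = refl
does-⇔ (yes p) (no ¬q) f g = ⊥-elim (¬q (f p))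
does-⇔ (no ¬p) (yes q) f g = ⊥-elim (¬p (g q))
does-⇔ (no ¬p) (no ¬q) f g = refl

sum-map-cong : {A : Set} {F F′ : A → ℕ} {L : List A} → All (λ a → F a ≡ F′ a) L → sum (map F L) ≡ sum (map F′ L)
sum-map-cong []         = refl
sum-map-cong (eq ∷ eqs) = cong₂ _+_ eq (sum-map-cong eqs)

∈⇒≤sum : {A : Set} (F : A → ℕ) {a : A} {L : List A} → a ∈ L → F a ≤ sum (map F L)
∈⇒≤sum F {L = b ∷ L} (here refl) = m≤m+n (F b) _
∈⇒≤sum F {L = b ∷ L} (there a∈L) = ≤-trans (∈⇒≤sum F a∈L) (m≤n+m _ (F b))

sum-zeros : {A : Set} (L : List A) → sum (map (λ _ → 0) L) ≡ 0
sum-zeros []      = refl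
sum-zeros (_ ∷ L) = sum-zeros L

∑-δ : ∀ {n} (j : Fin n) (φ : Fin n → ℕ) → ∑[ i < n ] (⟦ does (j Fin.≟ i) ⟧ * φ i) ≡ φ j
∑-δ {suc n} zero φ = begin
  1 * φ zero + ∑[ i < n ] 0  ≡⟨ cong₂ _+_ (*-identityˡ (φ zero)) (sum-replicate-zero n) ⟩
  φ zero + 0                 ≡⟨ +-identityʳ (φ zero) ⟩
  φ zero                     ∎
∑-δ {suc n} (suc j) φ = ∑-δ j (λ i → φ (suc i))

module Fibres {A : Set} {n : ℕ} (f : A → Fin n) where
  fibre : Fin n → List A → ℕ
  fibre i L = sum (map (λ a → ⟦ does (f a Fin.≟ i) ⟧) L)

  sum-by-fibres : (φ : Fin n → ℕ) (L : List A) → sum (map (λ a → φ (f a)) L) ≡ ∑[ i < n ] (fibre i L * φ i)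
  sum-by-fibres φ [] = sym (sum-replicate-zero n)
  sum-by-fibres φ (a ∷ L) = begin
    φ (f a) + sum (map (λ a → φ (f a)) L)
      ≡⟨ cong₂ _+_ (sym (∑-δ (f a) φ)) (sum-by-fibres φ L) ⟩
    ∑[ i < n ] (⟦ does (f a Fin.≟ i) ⟧ * φ i) + ∑[ i < n ] (fibre i L * φ i)
      ≡⟨ sym (∑-distrib-+ (λ i → ⟦ does (f a Fin.≟ i) ⟧ * φ i) (λ i → fibre i L * φ i)) ⟩
    ∑[ i < n ] (⟦ does (f a Fin.≟ i) ⟧ * φ i + fibre i L * φ i)
      ≡⟨ sum-cong-≗ (λ i → sym (*-distribʳ-+ (φ i) ⟦ does (f a Fin.≟ i) ⟧ (fibre i L))) ⟩
    ∑[ i < n ] (fibre i (a ∷ L) * φ i)  ∎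

∑-≥ : ∀ n (c : Fin n → ℕ) → (∀ i → 1 ≤ c i) → n ≤ ∑[ i < n ] c i
∑-≥ zero    c c≥1 = z≤n
∑-≥ (suc n) c c≥1 = +-mono-≤ (c≥1 zero) (∑-≥ n (λ i → c (suc i)) (λ i → c≥1 (suc i)))

head-and-tail : ∀ n (c : Fin (suc n) → ℕ) → (∀ i → 1 ≤ c i) → ∑[ i < suc n ] c i ≡ suc n →
  c zero ≡ 1 × ∑[ i < n ] c (suc i) ≡ n
head-and-tail n c c≥1 = split (c zero) _ (c≥1 zero) (∑-≥ n (λ i → c (suc i)) (λ i → c≥1 (suc i)))
  where
  split : ∀ a s → 1 ≤ a → n ≤ s → a + s ≡ suc n → a ≡ 1 × s ≡ n
  split (suc zero)    s _ n≤s eq = refl , suc-injective eq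
  split (suc (suc a)) s _ n≤s eq = ⊥-elim (≤⇒≯ (m≤n+m s a) (subst (_≤ s) (sym (suc-injective eq)) n≤s))

all-ones : ∀ n (c : Fin n → ℕ) → (∀ i → 1 ≤ c i) → ∑[ i < n ] c i ≡ n → ∀ i → c i ≡ 1
all-ones (suc n) c c≥1 ∑c≡n zero    = proj₁ (head-and-tail n c c≥1 ∑c≡n)
all-ones (suc n) c c≥1 ∑c≡n (suc i) =
  all-ones n (λ i → c (suc i)) (λ i → c≥1 (suc i)) (proj₂ (head-and-tail n c c≥1 ∑c≡n)) i


module _ {A : Set} where
  inl : (xs ys : List A) → Fin (length xs) → Fin (length (xs ++ ys))
  inl (x ∷ xs) ys zero    = zero
  inl (x ∷ xs) ys (suc i) = suc (inl xs ys i)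

  inr : (xs ys : List A) → Fin (length ys) → Fin (length (xs ++ ys))
  inr []       ys j = j
  inr (x ∷ xs) ys j = suc (inr xs ys j)

  lookup-inl : ∀ xs ys i → lookup (xs ++ ys) (inl xs ys i) ≡ lookup xs i
  lookup-inl (x ∷ xs) ys zero    = refl
  lookup-inl (x ∷ xs) ys (suc i) = lookup-inl xs ys i

  lookup-inr : ∀ xs ys j → lookup (xs ++ ys) (inr xs ys j) ≡ lookup ys j
  lookup-inr []       ys j = refl
  lookup-inr (x ∷ xs) ys j = lookup-inr xs ys j

  ∑-++ : ∀ xs ys (F : Fin (length (xs ++ ys)) → ℕ) →
    ∑[ k < length (xs ++ ys) ] F k ≡ ∑[ i < length xs ] F (inl xs ys i) + ∑[ j < length ys ] F (inr xs ys j)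
  ∑-++ []       ys F = refl
  ∑-++ (x ∷ xs) ys F = trans (cong (F zero +_) (∑-++ xs ys (λ k → F (suc k)))) (sym (+-assoc (F zero) _ _))

module _ {A B : Set} (f : A → B) where
  inm : (xs : List A) → Fin (length xs) → Fin (length (map f xs))
  inm (x ∷ xs) zero    = zero
  inm (x ∷ xs) (suc i) = suc (inm xs i)

  lookup-inm : ∀ xs i → lookup (map f xs) (inm xs i) ≡ f (lookup xs i)
  lookup-inm (x ∷ xs) zero    = refl
  lookup-inm (x ∷ xs) (suc i) = lookup-inm xs i

  ∑-map : ∀ xs (F : Fin (length (map f xs)) → ℕ) →
    ∑[ k < length (map f xs) ] F k ≡ ∑[ i < length xs ] F (inm xs i)
  ∑-map []       F = refl
  ∑-map (x ∷ xs) F = cong (F zero +_) (∑-map xs (λ k → F (suc k)))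

module Classify {A B : Set} (r : A → Maybe B) where
  dropped : List A → List A
  dropped []       = []
  dropped (a ∷ es) with r a
  ... | just _  = dropped es
  ... | nothing = a ∷ dropped es

  classify : (es : List A) → Fin (length es) → Fin (length (mapMaybe r es)) ⊎ A
  classify (a ∷ es) i with r a
  classify (a ∷ es) zero    | just _  = inj₁ zero
  classify (a ∷ es) (suc i) | just _  = Sum.map₁ suc (classify es i)
  classify (a ∷ es) zero    | nothing = inj₂ a
  classify (a ∷ es) (suc i) | nothing = classify es i

  ∑-classify : {C : Set} (es : List A) (h : Fin (length (mapMaybe r es)) ⊎ A → C)
    (W : A → C → ℕ) (W′ : B → C → ℕ) → (∀ a b c → r a ≡ just b → W a c ≡ W′ b c) →
    ∑[ i < length es ] W (lookup es i) (h (classify es i)) ≡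
    ∑[ j < length (mapMaybe r es) ] W′ (lookup (mapMaybe r es) j) (h (inj₁ j)) +
    sum (map (λ a → W a (h (inj₂ a))) (dropped es))
  ∑-classify []       h W W′ W≡W′ = refl
  ∑-classify (a ∷ es) h W W′ W≡W′ with r a in ra
  ... | just b  = begin
    W a (h (inj₁ zero)) + ∑[ i < length es ] W (lookup es i) (h (Sum.map₁ suc (classify es i)))
      ≡⟨ cong₂ _+_ (W≡W′ a b _ ra) (∑-classify es (λ k → h (Sum.map₁ suc k)) W W′ W≡W′) ⟩
    W′ b (h (inj₁ zero)) + (kept-sum + dropped-sum)
      ≡⟨ sym (+-assoc (W′ b (h (inj₁ zero))) kept-sum dropped-sum) ⟩
    W′ b (h (inj₁ zero)) + kept-sum + dropped-sum  ∎
    where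
    kept-sum dropped-sum : ℕ
    kept-sum = ∑[ j < length (mapMaybe r es) ] W′ (lookup (mapMaybe r es) j) (h (inj₁ (suc j)))
    dropped-sum = sum (map (λ a → W a (h (inj₂ a))) (dropped es))
  ... | nothing = begin
    W a (h (inj₂ a)) + ∑[ i < length es ] W (lookup es i) (h (classify es i))
      ≡⟨ cong (W a (h (inj₂ a)) +_) (∑-classify es h W W′ W≡W′) ⟩
    W a (h (inj₂ a)) + (kept-sum + dropped-sum)
      ≡⟨ x∙yz≈y∙xz (W a (h (inj₂ a))) kept-sum dropped-sum ⟩
    kept-sum + (W a (h (inj₂ a)) + dropped-sum)  ∎
    where
    kept-sum dropped-sum : ℕ
    kept-sum = ∑[ j < length (mapMaybe r es) ] W′ (lookup (mapMaybe r es) j) (h (inj₁ j))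
    dropped-sum = sum (map (λ a → W a (h (inj₂ a))) (dropped es))

  DroppedFrom : List A → A → Set
  DroppedFrom es x = r x ≡ nothing × ∃ λ i → lookup es i ≡ x

  shift : ∀ {es a x} → DroppedFrom es x → DroppedFrom (a ∷ es) x
  shift (rx , i , eq) = rx , suc i , eq

  dropped-spec : ∀ es → All (DroppedFrom es) (dropped es)
  dropped-spec []       = []
  dropped-spec (a ∷ es) with r a in ra
  ... | just _  = All.map shift (dropped-spec es)
  ... | nothing = (ra , zero , refl) ∷ All.map shift (dropped-spec es)

  ∈-dropped : ∀ es i → r (lookup es i) ≡ nothing → lookup es i ∈ dropped es
  ∈-dropped (a ∷ es) zero ra≡nothing with r a | ra≡nothing
  ... | nothing | _  = here refl
  ... | just _  | ()
  ∈-dropped (a ∷ es) (suc i) ra≡nothing with r a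
  ... | just _  = ∈-dropped es i ra≡nothing
  ... | nothing = there (∈-dropped es i ra≡nothing)

#E : Graph → ℕ
#E K = length (edges K)

fst snd : (K : Graph) → Edge K → V K
fst K e = proj₁ (ends K e)
snd K e = proj₂ (ends K e)

degIn-∑ : (K : Graph) (S : Edge K → Bool) (x : V K) →
  degIn K S x ≡ ∑[ e < #E K ] (S e ⊙ inc K x (ends K e))
degIn-∑ K S x = sum-allFin (#E K) (λ e → S e ⊙ inc K x (ends K e))

-- The sum of F over all edge-ends.  The vertex set is not given as a finite
-- list, so this replaces "3 · Σₓ F x" for a cubic graph.
endSum : (K : Graph) → (V K → ℕ) → ℕ
endSum K F = ∑[ e < #E K ] (F (fst K e) + F (snd K e))

endSum-cong : (K : Graph) {F F′ : V K → ℕ} → (∀ x → F x ≡ F′ x) → endSum K F ≡ endSum K F′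
endSum-cong K F≗F′ = sum-cong-≗ (λ e → cong₂ _+_ (F≗F′ (fst K e)) (F≗F′ (snd K e)))

endSum-+ : (K : Graph) (F F′ : V K → ℕ) → endSum K (λ x → F x + F′ x) ≡ endSum K F + endSum K F′
endSum-+ K F F′ = trans (sum-cong-≗ (λ e → interchange (F (fst K e)) (F′ (fst K e)) (F (snd K e)) (F′ (snd K e))))
                        (∑-distrib-+ (λ e → F (fst K e) + F (snd K e)) (λ e → F′ (fst K e) + F′ (snd K e)))

endSum-δ : (K : Graph) → Cubic K → (y : V K) → endSum K (δ (_≟_ K) y) ≡ 3
endSum-δ K cubic y = begin
  endSum K (δ (_≟_ K) y)                 ≡⟨ endSum-cong K (λ x → cong ⟦_⟧ (does-⇔ (_≟_ K y x) (_≟_ K x y) sym sym)) ⟩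
  endSum K (λ x → δ (_≟_ K) x y)         ≡⟨ sym (degIn-∑ K (λ _ → true) y) ⟩
  degree K y                             ≡⟨ cubic y ⟩
  3                                      ∎

endSum-⊙ : (K : Graph) (b : Bool) (F : V K → ℕ) → endSum K (λ z → b ⊙ F z) ≡ b ⊙ endSum K F
endSum-⊙ K true  F = refl
endSum-⊙ K false F = sum-replicate-zero (#E K)

endSum-selection : (K : Graph) → Cubic K → ∀ n (b : Fin n → Bool) (y : Fin n → V K) →
  endSum K (λ z → ∑[ i < n ] (b i ⊙ δ (_≟_ K) (y i) z)) ≡ 3 * ∑[ i < n ] ⟦ b i ⟧
endSum-selection K cubic n b y = begin
  endSum K (λ z → ∑[ i < n ] F i z)
    ≡⟨ sum-cong-≗ (λ e → sym (∑-distrib-+ (λ i → F i (fst K e)) (λ i → F i (snd K e)))) ⟩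
  ∑[ e < #E K ] ∑[ i < n ] (F i (fst K e) + F i (snd K e))
    ≡⟨ ∑-comm (λ e i → F i (fst K e) + F i (snd K e)) ⟩
  ∑[ i < n ] endSum K (F i)
    ≡⟨ sum-cong-≗ (λ i → trans (endSum-⊙ K (b i) (δ (_≟_ K) (y i))) (cong (b i ⊙_) (endSum-δ K cubic (y i)))) ⟩
  ∑[ i < n ] (b i ⊙ 3)
    ≡⟨ sum-cong-≗ (λ i → three-times (b i)) ⟩
  ∑[ i < n ] (3 * ⟦ b i ⟧)
    ≡⟨ sym (*-distribˡ-sum 3 (λ i → ⟦ b i ⟧)) ⟩
  3 * ∑[ i < n ] ⟦ b i ⟧  ∎
  where
  F : Fin n → V K → ℕ
  F i z = b i ⊙ δ (_≟_ K) (y i) z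
  three-times : ∀ c → c ⊙ 3 ≡ 3 * ⟦ c ⟧
  three-times true  = refl
  three-times false = refl

module Handshake (K : Graph) (cubic : Cubic K) (w : V K → ℕ) where
  meet : V K × V K → V K × V K → ℕ
  meet (a , b) q = w a * inc K a q + w b * inc K b q

  meet-sym : ∀ p q → meet p q ≡ meet q p
  meet-sym (a , b) (c , d) = begin
    w a * (δ′ c a + δ′ d a) + w b * (δ′ c b + δ′ d b)
      ≡⟨ expandˡ (w a) (w b) (δ′ c a) (δ′ d a) (δ′ c b) (δ′ d b) ⟩
    (w a * δ′ c a + w b * δ′ c b) + (w a * δ′ d a + w b * δ′ d b)
      ≡⟨ cong₂ _+_ (cong₂ _+_ (swap a c) (swap b c)) (cong₂ _+_ (swap a d) (swap b d)) ⟩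
    (w c * δ′ a c + w c * δ′ b c) + (w d * δ′ a d + w d * δ′ b d)
      ≡⟨ sym (cong₂ _+_ (*-distribˡ-+ (w c) _ _) (*-distribˡ-+ (w d) _ _)) ⟩
    w c * (δ′ a c + δ′ b c) + w d * (δ′ a d + δ′ b d)  ∎
    where
    δ′ : V K → V K → ℕ
    δ′ = δ (_≟_ K)
    swap : ∀ x y → w x * δ′ y x ≡ w y * δ′ x y
    swap x y with _≟_ K y x | _≟_ K x y
    ... | yes refl | yes _  = refl
    ... | yes refl | no x≢x = ⊥-elim (x≢x refl)
    ... | no y≢y   | yes refl = ⊥-elim (y≢y refl)
    ... | no _     | no _   = trans (*-zeroʳ (w x)) (sym (*-zeroʳ (w y)))
    expandˡ : ∀ wa wb x₁ x₂ x₃ x₄ → wa * (x₁ + x₂) + wb * (x₃ + x₄) ≡ (wa * x₁ + wb * x₃) + (wa * x₂ + wb * x₄)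
    expandˡ = solve 6 (λ wa wb x₁ x₂ x₃ x₄ → wa :* (x₁ :+ x₂) :+ wb :* (x₃ :+ x₄) := (wa :* x₁ :+ wb :* x₃) :+ (wa :* x₂ :+ wb :* x₄)) refl

  ends-deg : (S : Edge K → Bool) (p : V K × V K) →
    w (proj₁ p) * degIn K S (proj₁ p) + w (proj₂ p) * degIn K S (proj₂ p) ≡ ∑[ e < #E K ] (S e ⊙ meet p (ends K e))
  ends-deg S (a , b) = begin
    w a * degIn K S a + w b * degIn K S b
      ≡⟨ cong₂ _+_ (weigh a) (weigh b) ⟩
    ∑[ e < #E K ] (S e ⊙ (w a * inc K a (ends K e))) + ∑[ e < #E K ] (S e ⊙ (w b * inc K b (ends K e)))
      ≡⟨ sym (∑-distrib-+ (λ e → S e ⊙ (w a * inc K a (ends K e))) (λ e → S e ⊙ (w b * inc K b (ends K e)))) ⟩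
    ∑[ e < #E K ] (S e ⊙ (w a * inc K a (ends K e)) + S e ⊙ (w b * inc K b (ends K e)))
      ≡⟨ sum-cong-≗ (λ e → sym (⊙-+ (S e) _ _)) ⟩
    ∑[ e < #E K ] (S e ⊙ meet (a , b) (ends K e))  ∎
    where
    weigh : ∀ x → w x * degIn K S x ≡ ∑[ e < #E K ] (S e ⊙ (w x * inc K x (ends K e)))
    weigh x = trans (cong (w x *_) (degIn-∑ K S x))
                    (trans (*-distribˡ-sum (w x) (λ e → S e ⊙ inc K x (ends K e))) (sum-cong-≗ (λ e → *-⊙ (w x) (S e) _)))

  handshake : (S : Edge K → Bool) →
    endSum K (λ x → w x * degIn K S x) ≡ 3 * ∑[ e < #E K ] (S e ⊙ (w (fst K e) + w (snd K e)))
  handshake S = begin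
    endSum K (λ x → w x * degIn K S x)
      ≡⟨ sum-cong-≗ (λ f → ends-deg S (ends K f)) ⟩
    ∑[ f < #E K ] ∑[ e < #E K ] (S e ⊙ meet (ends K f) (ends K e))
      ≡⟨ ∑-comm (λ f e → S e ⊙ meet (ends K f) (ends K e)) ⟩
    ∑[ e < #E K ] ∑[ f < #E K ] (S e ⊙ meet (ends K f) (ends K e))
      ≡⟨ sum-cong-≗ (λ e → trans (sum-cong-≗ (λ f → cong (S e ⊙_) (meet-sym (ends K f) (ends K e))))
                                 (sym (⊙-∑ (#E K) (S e) (λ f → meet (ends K e) (ends K f))))) ⟩
    ∑[ e < #E K ] (S e ⊙ ∑[ f < #E K ] meet (ends K e) (ends K f))
      ≡⟨ sum-cong-≗ (λ e → cong (S e ⊙_) (trans (sym (ends-deg (λ _ → true) (ends K e))) (three-ends e))) ⟩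
    ∑[ e < #E K ] (S e ⊙ (3 * (w (fst K e) + w (snd K e))))
      ≡⟨ sum-cong-≗ (λ e → sym (*-⊙ 3 (S e) _)) ⟩
    ∑[ e < #E K ] (3 * (S e ⊙ (w (fst K e) + w (snd K e))))
      ≡⟨ sym (*-distribˡ-sum 3 (λ e → S e ⊙ (w (fst K e) + w (snd K e)))) ⟩
    3 * ∑[ e < #E K ] (S e ⊙ (w (fst K e) + w (snd K e)))  ∎
    where
    three-ends : ∀ e → w (fst K e) * degree K (fst K e) + w (snd K e) * degree K (snd K e)
                       ≡ 3 * (w (fst K e) + w (snd K e))
    three-ends e = begin
      w (fst K e) * degree K (fst K e) + w (snd K e) * degree K (snd K e)
        ≡⟨ cong₂ (λ m n → w (fst K e) * m + w (snd K e) * n) (cubic (fst K e)) (cubic (snd K e)) ⟩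
      w (fst K e) * 3 + w (snd K e) * 3
        ≡⟨ cong₂ _+_ (*-comm (w (fst K e)) 3) (*-comm (w (snd K e)) 3) ⟩
      3 * w (fst K e) + 3 * w (snd K e)
        ≡⟨ sym (*-distribˡ-+ 3 (w (fst K e)) (w (snd K e))) ⟩
      3 * (w (fst K e) + w (snd K e))  ∎

-- Cubic bipartite graphs are balanced: if an edge set S, together with
-- "defects" p on one colour class and q on the other, covers every vertex
-- exactly once, then the total defects on the two sides agree.  (Each
-- colour class meets every edge once, so weighting by either class turns
-- the handshake lemma into the same count 3·|S|.)
module Balance (K : Graph) (cubic : Cubic K) (colour : V K → Bool)
               (proper : ∀ e → colour (fst K e) ≢ colour (snd K e)) where

  class : Bool → V K → ℕ
  class b z = ⟦ does (colour z Bool.≟ b) ⟧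

  class-meets-edge : ∀ b e → class b (fst K e) + class b (snd K e) ≡ 1
  class-meets-edge b e = one (colour (fst K e)) (colour (snd K e)) b (proper e)
    where
    one : ∀ x y b → x ≢ y → ⟦ does (x Bool.≟ b) ⟧ + ⟦ does (y Bool.≟ b) ⟧ ≡ 1
    one false false _     x≢y = ⊥-elim (x≢y refl)
    one true  true  _     x≢y = ⊥-elim (x≢y refl)
    one false true  false _   = refl
    one false true  true  _   = refl
    one true  false false _   = refl
    one true  false true  _   = refl

  class-keeps : ∀ b z n → (colour z ≢ b → n ≡ 0) → class b z * n ≡ n
  class-keeps b z n outside⇒0 with colour z Bool.≟ b
  ... | yes _   = +-identityʳ n
  ... | no  z∉b = sym (outside⇒0 z∉b)

  class-kills : ∀ b z n → (colour z ≡ b → n ≡ 0) → class b z * n ≡ 0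
  class-kills b z n inside⇒0 with colour z Bool.≟ b
  ... | yes z∈b = trans (+-identityʳ n) (inside⇒0 z∈b)
  ... | no  _   = refl

  weighted-cover : ∀ w d p q → w * p ≡ p → w * q ≡ 0 → d + p + q ≡ 1 → w * d + p ≡ w
  weighted-cover w d p q wp≡p wq≡0 cover = begin
    w * d + p            ≡⟨ sym (+-identityʳ _) ⟩
    w * d + p + 0        ≡⟨ cong₂ (λ m n → w * d + m + n) (sym wp≡p) (sym wq≡0) ⟩
    w * d + w * p + w * q  ≡⟨ sym (distrib₃ w d p q) ⟩
    w * (d + p + q)      ≡⟨ cong (w *_) cover ⟩
    w * 1                ≡⟨ *-identityʳ w ⟩
    w                    ∎
    where
    distrib₃ : ∀ w a b c → w * (a + b + c) ≡ w * a + w * b + w * c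
    distrib₃ = solve 4 (λ w a b c → w :* (a :+ b :+ c) := w :* a :+ w :* b :+ w :* c) refl

  class-count : ∀ S b (p q : V K → ℕ) → (∀ z → colour z ≢ b → p z ≡ 0) → (∀ z → colour z ≡ b → q z ≡ 0) →
    (∀ z → degIn K S z + p z + q z ≡ 1) →
    3 * ∑[ e < #E K ] (S e ⊙ 1) + endSum K p ≡ ∑[ e < #E K ] 1
  class-count S b p q p⊆b q∩b≡∅ cover = begin
    3 * ∑[ e < #E K ] (S e ⊙ 1) + endSum K p
      ≡⟨ cong (λ n → 3 * n + endSum K p) (sym (sum-cong-≗ λ e → cong (S e ⊙_) (class-meets-edge b e))) ⟩
    3 * ∑[ e < #E K ] (S e ⊙ (class b (fst K e) + class b (snd K e))) + endSum K p
      ≡⟨ cong (_+ endSum K p) (sym (Handshake.handshake K cubic (class b) S)) ⟩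
    endSum K (λ z → class b z * degIn K S z) + endSum K p
      ≡⟨ sym (endSum-+ K (λ z → class b z * degIn K S z) p) ⟩
    endSum K (λ z → class b z * degIn K S z + p z)
      ≡⟨ endSum-cong K (λ z → weighted-cover (class b z) (degIn K S z) (p z) (q z)
                                 (class-keeps b z (p z) (p⊆b z)) (class-kills b z (q z) (q∩b≡∅ z)) (cover z)) ⟩
    endSum K (class b)
      ≡⟨ sum-cong-≗ (class-meets-edge b) ⟩
    ∑[ e < #E K ] 1  ∎

  balance : ∀ S b (p q : V K → ℕ) → (∀ z → colour z ≢ b → p z ≡ 0) → (∀ z → colour z ≡ b → q z ≡ 0) →
    (∀ z → degIn K S z + p z + q z ≡ 1) → endSum K p ≡ endSum K q
  balance S b p q p⊆b q∩b≡∅ cover =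
    +-cancelˡ-≡ (3 * ∑[ e < #E K ] (S e ⊙ 1)) (endSum K p) (endSum K q)
      (trans (class-count S b p q p⊆b q∩b≡∅ cover)
             (sym (class-count S (not b) q p q⊆¬b p∩¬b≡∅ cover′)))
    where
    q⊆¬b : ∀ z → colour z ≢ not b → q z ≡ 0
    q⊆¬b z z∉¬b = q∩b≡∅ z (trans (¬-not z∉¬b) (not-involutive b))
    p∩¬b≡∅ : ∀ z → colour z ≡ not b → p z ≡ 0
    p∩¬b≡∅ z z∈¬b = p⊆b z (λ z∈b → not-¬ z∈b z∈¬b)
    cover′ : ∀ z → degIn K S z + q z + p z ≡ 1
    cover′ z = trans (xy∙z≈xz∙y (degIn K S z) (q z) (p z)) (cover z)

punct : (K : Graph) {w x : V K} → x ≢ w → Punct K w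
punct K {x = x} x≢w = x , fromWitnessFalse x≢w

punct-≢ : (K : Graph) {w : V K} (p : Punct K w) → proj₁ p ≢ w
punct-≢ K p = toWitnessFalse (proj₂ p)

punct-≡ : (K : Graph) {w : V K} (p q : Punct K w) → proj₁ p ≡ proj₁ q → p ≡ q
punct-≡ K (x , p) (.x , q) refl = cong (x ,_) (T-irrelevant p q)

δ-punct : (K : Graph) (w : V K) (p q : Punct K w) →
  δ (Punct-≟ K w) p q ≡ δ (_≟_ K) (proj₁ p) (proj₁ q)
δ-punct K w p q = cong ⟦_⟧ (does-⇔ (Punct-≟ K w p q) (_≟_ K (proj₁ p) (proj₁ q)) (cong proj₁) (punct-≡ K p q))

δ-inj₁ : {A B : Set} (_≟A_ : DecidableEquality A) (_≟B_ : DecidableEquality B) (a a′ : A) →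
  δ (⊎-≟ _≟A_ _≟B_) (inj₁ a) (inj₁ a′) ≡ δ _≟A_ a a′
δ-inj₁ _≟A_ _≟B_ a a′ = cong ⟦_⟧ (does-⇔ (⊎-≟ _≟A_ _≟B_ (inj₁ a) (inj₁ a′)) (a ≟A a′) inj₁-injective (cong inj₁))

δ-inj₂ : {A B : Set} (_≟A_ : DecidableEquality A) (_≟B_ : DecidableEquality B) (b b′ : B) →
  δ (⊎-≟ _≟A_ _≟B_) (inj₂ b) (inj₂ b′) ≡ δ _≟B_ b b′
δ-inj₂ _≟A_ _≟B_ b b′ = cong ⟦_⟧ (does-⇔ (⊎-≟ _≟A_ _≟B_ (inj₂ b) (inj₂ b′)) (b ≟B b′) inj₂-injective (cong inj₂))

lift : (K : Graph) {w : V K} → Punct K w × Punct K w → V K × V K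
lift K (a , b) = proj₁ a , proj₁ b

inc-lift : (K : Graph) {w : V K} (p : Punct K w × Punct K w) → inc K w (lift K p) ≡ 0
inc-lift K {w} (a , b) rewrite dec-false (_≟_ K (proj₁ a) w) (punct-≢ K a)
                            | dec-false (_≟_ K (proj₁ b) w) (punct-≢ K b) = refl

deleted-at : (K : Graph) (w : V K) (B : Fin (length (deleteEdges K w)) → Bool) →
  ∑[ j < length (deleteEdges K w) ] (B j ⊙ inc K w (lift K (lookup (deleteEdges K w) j))) ≡ 0
deleted-at K w B = trans (sum-cong-≗ λ j → cong (B j ⊙_) (inc-lift K (lookup (deleteEdges K w) j)))
                         (∑-⊙-zero (length (deleteEdges K w)) B)

restrict-kept : (K : Graph) (w : V K) (a : V K × V K) {p : Punct K w × Punct K w} →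
  restrictEdge K w a ≡ just p → a ≡ lift K p
restrict-kept K w (x , y) eq with _≟_ K x w | _≟_ K y w
restrict-kept K w (x , y) refl | no _ | no _  = refl
restrict-kept K w (x , y) ()   | yes _ | _
restrict-kept K w (x , y) ()   | no _ | yes _

restrict-dropped : (K : Graph) (w : V K) (a : V K × V K) →
  restrictEdge K w a ≡ nothing → proj₁ a ≡ w ⊎ proj₂ a ≡ w
restrict-dropped K w (x , y) eq with _≟_ K x w | _≟_ K y w
restrict-dropped K w (x , y) () | no _     | no _
restrict-dropped K w (x , y) _  | yes x≡w | _        = inj₁ x≡w
restrict-dropped K w (x , y) _  | no _     | yes y≡w = inj₂ y≡w

restrict-at : (K : Graph) (w : V K) (a : V K × V K) →
  proj₁ a ≡ w ⊎ proj₂ a ≡ w → restrictEdge K w a ≡ nothing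
restrict-at K w (x , y) at with _≟_ K x w | _≟_ K y w
restrict-at K w (x , y) _         | yes _ | _     = refl
restrict-at K w (x , y) _         | no _  | yes _ = refl
restrict-at K w (x , y) (inj₁ x≡w) | no x≢w | no _  = ⊥-elim (x≢w x≡w)
restrict-at K w (x , y) (inj₂ y≡w) | no _  | no y≢w = ⊥-elim (y≢w y≡w)

listed-adjacent : (K : Graph) {x : V K} (y : Fin 3 → V K) →
  NeighbourhoodIs K x (y zero) (y (suc zero)) (y (suc (suc zero))) → ∀ i → Adj K x (y i)
listed-adjacent K y (_ , _ , _ , N[x]) zero             = Equivalence.from (N[x] _) (inj₁ refl)
listed-adjacent K y (_ , _ , _ , N[x]) (suc zero)       = Equivalence.from (N[x] _) (inj₂ (inj₁ refl))
listed-adjacent K y (_ , _ , _ , N[x]) (suc (suc zero)) = Equivalence.from (N[x] _) (inj₂ (inj₂ refl))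

module Join (G H : Graph) (u : V G) (u₁ u₂ u₃ : Punct G u) (v : V H) (v₁ v₂ v₃ : Punct H v) where

  J : Graph
  J = join G H u u₁ u₂ u₃ v v₁ v₂ v₃

  us : Fin 3 → Punct G u
  us zero             = u₁
  us (suc zero)       = u₂
  us (suc (suc zero)) = u₃

  vs : Fin 3 → Punct H v
  vs zero             = v₁
  vs (suc zero)       = v₂
  vs (suc (suc zero)) = v₃

  embG : Punct G u × Punct G u → V J × V J
  embG (a , b) = inj₁ a , inj₁ b

  embH : Punct H v × Punct H v → V J × V J
  embH (a , b) = inj₂ a , inj₂ b

  cut : List (V J × V J)
  cut = (inj₁ u₁ , inj₂ v₁) ∷ (inj₁ u₂ , inj₂ v₂) ∷ (inj₁ u₃ , inj₂ v₃) ∷ []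

  cut-ends : ∀ i → lookup cut i ≡ (inj₁ (us i) , inj₂ (vs i))
  cut-ends zero             = refl
  cut-ends (suc zero)       = refl
  cut-ends (suc (suc zero)) = refl

  EG : List (Punct G u × Punct G u)
  EG = deleteEdges G u

  EH : List (Punct H v × Punct H v)
  EH = deleteEdges H v

  gEdge : Fin (length EG) → Edge J
  gEdge j = inl (map embG EG) (map embH EH ++ cut) (inm embG EG j)

  hEdge : Fin (length EH) → Edge J
  hEdge j = inr (map embG EG) (map embH EH ++ cut) (inl (map embH EH) cut (inm embH EH j))

  cutEdge : Fin 3 → Edge J
  cutEdge i = inr (map embG EG) (map embH EH ++ cut) (inr (map embH EH) cut i)

  ∑-J : (F : Edge J → ℕ) →
    ∑[ k < #E J ] F k ≡ ∑[ j < length EG ] F (gEdge j) + (∑[ j < length EH ] F (hEdge j) + ∑[ i < 3 ] F (cutEdge i))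
  ∑-J F = trans (∑-++ (map embG EG) (map embH EH ++ cut) F)
                (cong₂ _+_ (∑-map embG EG (λ k → F (inl (map embG EG) (map embH EH ++ cut) k)))
                           (trans (∑-++ (map embH EH) cut hc)
                                  (cong (_+ ∑[ i < 3 ] F (cutEdge i)) (∑-map embH EH (λ k → hc (inl (map embH EH) cut k))))))
    where
    hc : Fin (length (map embH EH ++ cut)) → ℕ
    hc k = F (inr (map embG EG) (map embH EH ++ cut) k)

  gEdge-ends : ∀ j → ends J (gEdge j) ≡ embG (lookup EG j)
  gEdge-ends j = trans (lookup-inl (map embG EG) (map embH EH ++ cut) (inm embG EG j)) (lookup-inm embG EG j)

  hEdge-ends : ∀ j → ends J (hEdge j) ≡ embH (lookup EH j)
  hEdge-ends j = trans (lookup-inr (map embG EG) (map embH EH ++ cut) (inl (map embH EH) cut (inm embH EH j)))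
                       (trans (lookup-inl (map embH EH) cut (inm embH EH j)) (lookup-inm embH EH j))

  cutEdge-ends : ∀ i → ends J (cutEdge i) ≡ (inj₁ (us i) , inj₂ (vs i))
  cutEdge-ends i = trans (lookup-inr (map embG EG) (map embH EH ++ cut) (inr (map embH EH) cut i))
                         (trans (lookup-inr (map embH EH) cut i) (cut-ends i))

  degIn-J : (M : Edge J → Bool) (y : V J) → degIn J M y ≡
    ∑[ j < length EG ] (M (gEdge j) ⊙ inc J y (embG (lookup EG j))) +
    (∑[ j < length EH ] (M (hEdge j) ⊙ inc J y (embH (lookup EH j))) +
     ∑[ i < 3 ] (M (cutEdge i) ⊙ inc J y (inj₁ (us i) , inj₂ (vs i))))
  degIn-J M y = trans (degIn-∑ J M y) (trans (∑-J (λ k → at k (ends J k)))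
    (cong₂ _+_ (sum-cong-≗ λ j → cong (at (gEdge j)) (gEdge-ends j))
               (cong₂ _+_ (sum-cong-≗ λ j → cong (at (hEdge j)) (hEdge-ends j))
                          (sum-cong-≗ λ i → cong (at (cutEdge i)) (cutEdge-ends i)))))
    where
    at : Edge J → V J × V J → ℕ
    at k p = M k ⊙ inc J y p

  degG : (M : Edge J → Bool) → V G → ℕ
  degG M x = ∑[ j < length EG ] (M (gEdge j) ⊙ inc G x (lift G (lookup EG j)))

  cutG : (M : Edge J → Bool) → V G → ℕ
  cutG M x = ∑[ i < 3 ] (M (cutEdge i) ⊙ δ (_≟_ G) (proj₁ (us i)) x)

  degH : (M : Edge J → Bool) → V H → ℕ
  degH M z = ∑[ j < length EH ] (M (hEdge j) ⊙ inc H z (lift H (lookup EH j)))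

  cutH : (M : Edge J → Bool) → V H → ℕ
  cutH M z = ∑[ i < 3 ] (M (cutEdge i) ⊙ δ (_≟_ H) (proj₁ (vs i)) z)

  degIn-J-G : (M : Edge J → Bool) (x : Punct G u) → degIn J M (inj₁ x) ≡ degG M (proj₁ x) + cutG M (proj₁ x)
  degIn-J-G M x = begin
    degIn J M (inj₁ x)
      ≡⟨ degIn-J M (inj₁ x) ⟩
    ∑[ j < length EG ] (M (gEdge j) ⊙ inc J (inj₁ x) (embG (lookup EG j))) +
    (∑[ j < length EH ] (M (hEdge j) ⊙ 0) + ∑[ i < 3 ] (M (cutEdge i) ⊙ (δJ (inj₁ (us i)) (inj₁ x) + 0)))
      ≡⟨ cong₂ _+_ (sum-cong-≗ λ j → cong (M (gEdge j) ⊙_) (same-inc (lookup EG j)))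
                   (cong₂ _+_ (∑-⊙-zero (length EH) (λ j → M (hEdge j)))
                              (sum-cong-≗ λ i → cong (M (cutEdge i) ⊙_) (trans (+-identityʳ _) (δG (us i) x)))) ⟩
    degG M (proj₁ x) + (0 + cutG M (proj₁ x))  ∎
    where
    δJ : V J → V J → ℕ
    δJ = δ (_≟_ J)
    δG : ∀ p q → δJ (inj₁ p) (inj₁ q) ≡ δ (_≟_ G) (proj₁ p) (proj₁ q)
    δG p q = trans (δ-inj₁ (Punct-≟ G u) (Punct-≟ H v) p q) (δ-punct G u p q)
    same-inc : ∀ p → inc J (inj₁ x) (embG p) ≡ inc G (proj₁ x) (lift G p)
    same-inc (a , b) = cong₂ _+_ (δG a x) (δG b x)

  degIn-J-H : (M : Edge J → Bool) (z : Punct H v) → degIn J M (inj₂ z) ≡ degH M (proj₁ z) + cutH M (proj₁ z)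
  degIn-J-H M z = begin
    degIn J M (inj₂ z)
      ≡⟨ degIn-J M (inj₂ z) ⟩
    ∑[ j < length EG ] (M (gEdge j) ⊙ 0) +
    (∑[ j < length EH ] (M (hEdge j) ⊙ inc J (inj₂ z) (embH (lookup EH j))) + ∑[ i < 3 ] (M (cutEdge i) ⊙ δJ (inj₂ (vs i)) (inj₂ z)))
      ≡⟨ cong₂ _+_ (∑-⊙-zero (length EG) (λ j → M (gEdge j)))
                   (cong₂ _+_ (sum-cong-≗ λ j → cong (M (hEdge j) ⊙_) (same-inc (lookup EH j)))
                              (sum-cong-≗ λ i → cong (M (cutEdge i) ⊙_) (δH (vs i) z))) ⟩
    degH M (proj₁ z) + cutH M (proj₁ z)  ∎
    where
    δJ : V J → V J → ℕ
    δJ = δ (_≟_ J)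
    δH : ∀ p q → δJ (inj₂ p) (inj₂ q) ≡ δ (_≟_ H) (proj₁ p) (proj₁ q)
    δH p q = trans (δ-inj₂ (Punct-≟ G u) (Punct-≟ H v) p q) (δ-punct H v p q)
    same-inc : ∀ p → inc J (inj₂ z) (embH p) ≡ inc H (proj₁ z) (lift H p)
    same-inc (a , b) = cong₂ _+_ (δH a z) (δH b z)

  -- Projection to G.  An edge of G - u keeps its status, and the edge from
  -- u to uᵢ inherits the status of the cut edge uᵢvᵢ.
  module ToG (cubicG : Cubic G) (nbG : NeighbourhoodIs G u (proj₁ u₁) (proj₁ u₂) (proj₁ u₃)) where
    open Classify (restrictEdge G u)

    u₁≢u₂ : proj₁ u₁ ≢ proj₁ u₂
    u₁≢u₂ = proj₁ nbG
    u₁≢u₃ : proj₁ u₁ ≢ proj₁ u₃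
    u₁≢u₃ = proj₁ (proj₂ nbG)
    u₂≢u₃ : proj₁ u₂ ≢ proj₁ u₃
    u₂≢u₃ = proj₁ (proj₂ (proj₂ nbG))

    which : V G → Fin 3
    which y = if does (_≟_ G y (proj₁ u₁)) then zero
              else if does (_≟_ G y (proj₁ u₂)) then suc zero else suc (suc zero)

    which-us : ∀ i → which (proj₁ (us i)) ≡ i
    which-us zero
      rewrite dec-true (_≟_ G (proj₁ u₁) (proj₁ u₁)) refl = refl
    which-us (suc zero)
      rewrite dec-false (_≟_ G (proj₁ u₂) (proj₁ u₁)) (λ eq → u₁≢u₂ (sym eq))
            | dec-true (_≟_ G (proj₁ u₂) (proj₁ u₂)) refl = refl
    which-us (suc (suc zero))
      rewrite dec-false (_≟_ G (proj₁ u₃) (proj₁ u₁)) (λ eq → u₁≢u₃ (sym eq))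
            | dec-false (_≟_ G (proj₁ u₃) (proj₁ u₂)) (λ eq → u₂≢u₃ (sym eq)) = refl

    us-which : ∀ {y} → Adj G u y → proj₁ (us (which y)) ≡ y
    us-which {y} adj with Equivalence.to (proj₂ (proj₂ (proj₂ nbG)) y) adj
    ... | inj₁ refl        = cong (λ i → proj₁ (us i)) (which-us zero)
    ... | inj₂ (inj₁ refl) = cong (λ i → proj₁ (us i)) (which-us (suc zero))
    ... | inj₂ (inj₂ refl) = cong (λ i → proj₁ (us i)) (which-us (suc (suc zero)))

    other : V G × V G → V G
    other (a , b) = if does (_≟_ G a u) then b else a

    slot : V G × V G → Fin 3
    slot p = which (other p)

    atU : List (V G × V G)
    atU = dropped (edges G)

    AtU : V G × V G → Set
    AtU p = (inc G u p ≡ 1) × (∀ x → x ≢ u → inc G x p ≡ δ (_≟_ G) (proj₁ (us (slot p))) x)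

    -- every edge at u is such an edge: its other end is adjacent to u, so it
    -- is one of the uᵢ (in particular not u, so G has no loop at u)
    pair-at-u : ∀ a b (e : Edge G) → ends G e ≡ (a , b) → a ≡ u ⊎ b ≡ u → AtU (a , b)
    pair-at-u a b e eq touches with _≟_ G a u
    pair-at-u .u b e eq _ | yes refl
      rewrite dec-false (_≟_ G b u) (λ b≡u → punct-≢ G (us (which b)) (trans (us-which (e , (λ ()) , inj₁ eq)) b≡u)) =
      refl , λ x x≢u → trans (cong (_+ δ (_≟_ G) b x) (cong ⟦_⟧ (dec-false (_≟_ G u x) (λ u≡x → x≢u (sym u≡x)))))
                             (cong (λ y → δ (_≟_ G) y x) (sym (us-which adj)))
      where
      adj : Adj G u b
      adj = e , (λ ()) , inj₁ eq
    pair-at-u a b e eq (inj₁ a≡u)  | no a≢u = ⊥-elim (a≢u a≡u)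
    pair-at-u a .u e eq (inj₂ refl) | no a≢u
      rewrite dec-true (_≟_ G u u) refl =
      refl , λ x x≢u → trans (cong (δ (_≟_ G) a x +_) (cong ⟦_⟧ (dec-false (_≟_ G u x) (λ u≡x → x≢u (sym u≡x)))))
                             (trans (+-identityʳ _) (cong (λ y → δ (_≟_ G) y x) (sym (us-which adj))))
      where
      adj : Adj G u a
      adj = e , (λ ()) , inj₂ eq

    dropped-at-u : All AtU atU
    dropped-at-u = All.map at-u (dropped-spec (edges G))
      where
      at-u : ∀ {p} → DroppedFrom (edges G) p → AtU p
      at-u {a , b} (r≡nothing , e , eq) = pair-at-u a b e eq (restrict-dropped G u (a , b) r≡nothing)

    partner : Edge G → Edge J
    partner e = [ gEdge , (λ p → cutEdge (slot p)) ]′ (classify (edges G) e)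

    toG : (Edge J → Bool) → Edge G → Bool
    toG M e = M (partner e)

    degIn-toG : ∀ M x → degIn G (toG M) x ≡ degG M x + sum (map (λ p → M (cutEdge (slot p)) ⊙ inc G x p) atU)
    degIn-toG M x = trans (degIn-∑ G (toG M) x)
      (∑-classify (edges G) (λ k → M ([ gEdge , (λ p → cutEdge (slot p)) ]′ k))
                  (λ p c → c ⊙ inc G x p) (λ q c → c ⊙ inc G x (lift G q))
                  (λ p q c r≡q → cong (λ p′ → c ⊙ inc G x p′) (restrict-kept G u p r≡q)))

    degree-u : sum (map (inc G u) atU) ≡ 3
    degree-u = begin
      sum (map (inc G u) atU)                   ≡⟨ cong (_+ sum (map (inc G u) atU)) (sym (deleted-at G u (λ _ → true))) ⟩
      degG all u + sum (map (inc G u) atU)      ≡⟨ sym (degIn-toG all u) ⟩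
      degree G u                                ≡⟨ cubicG u ⟩
      3                                         ∎
      where
      all : Edge J → Bool
      all _ = true

    open Fibres slot

    edge-to : ∀ {y} (e : Edge G) → ends G e ≡ (u , y) ⊎ ends G e ≡ (y , u) → y ≢ u →
      ends G e ∈ atU × other (ends G e) ≡ y
    edge-to {y} e (inj₁ eq) y≢u =
      ∈-dropped (edges G) e (restrict-at G u (ends G e) (inj₁ (cong proj₁ eq))) ,
      trans (cong other eq) (cong (λ b → if b then y else u) (dec-true (_≟_ G u u) refl))
    edge-to {y} e (inj₂ eq) y≢u =
      ∈-dropped (edges G) e (restrict-at G u (ends G e) (inj₂ (cong proj₂ eq))) ,
      trans (cong other eq) (cong (λ b → if b then u else y) (dec-false (_≟_ G y u) y≢u))

    fibre-≥1 : ∀ i → 1 ≤ fibre i atU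
    fibre-≥1 i with listed-adjacent G (λ i → proj₁ (us i)) nbG i
    ... | e , _ , ends≡ with edge-to e ends≡ (punct-≢ G (us i))
    ...   | e∈atU , other≡uᵢ = subst (_≤ fibre i atU) slot≡i (∈⇒≤sum (λ p → ⟦ does (slot p Fin.≟ i) ⟧) e∈atU)
      where
      slot≡i : ⟦ does (slot (ends G e) Fin.≟ i) ⟧ ≡ 1
      slot≡i rewrite other≡uᵢ | which-us i | dec-true (i Fin.≟ i) refl = refl

    fibre-sum : ∑[ i < 3 ] fibre i atU ≡ 3
    fibre-sum = begin
      ∑[ i < 3 ] fibre i atU              ≡⟨ sum-cong-≗ (λ i → sym (*-identityʳ (fibre i atU))) ⟩
      ∑[ i < 3 ] (fibre i atU * 1)        ≡⟨ sym (sum-by-fibres (λ _ → 1) atU) ⟩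
      sum (map (λ _ → 1) atU)             ≡⟨ sum-map-cong (All.map (λ at → sym (proj₁ at)) dropped-at-u) ⟩
      sum (map (inc G u) atU)             ≡⟨ degree-u ⟩
      3                                   ∎

    star-sum : (φ : Fin 3 → ℕ) → sum (map (λ p → φ (slot p)) atU) ≡ ∑[ i < 3 ] φ i
    star-sum φ = trans (sum-by-fibres φ atU)
      (sum-cong-≗ λ i → trans (cong (_* φ i) (all-ones 3 (λ i → fibre i atU) fibre-≥1 fibre-sum i)) (*-identityˡ (φ i)))

    toG-perfect : ∀ M → IsPerfectMatching J M → ∑[ i < 3 ] ⟦ M (cutEdge i) ⟧ ≡ 1 → IsPerfectMatching G (toG M)
    toG-perfect M perfect one-cut x with _≟_ G x u
    ... | yes refl = begin
      degIn G (toG M) u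
        ≡⟨ degIn-toG M u ⟩
      degG M u + sum (map (λ p → M (cutEdge (slot p)) ⊙ inc G u p) atU)
        ≡⟨ cong₂ _+_ (deleted-at G u (λ j → M (gEdge j))) (sum-map-cong (All.map (λ {p} at → cong (M (cutEdge (slot p)) ⊙_) (proj₁ at)) dropped-at-u)) ⟩
      sum (map (λ p → ⟦ M (cutEdge (slot p)) ⟧) atU)
        ≡⟨ star-sum (λ i → ⟦ M (cutEdge i) ⟧) ⟩
      ∑[ i < 3 ] ⟦ M (cutEdge i) ⟧
        ≡⟨ one-cut ⟩
      1  ∎
    ... | no x≢u = begin
      degIn G (toG M) x
        ≡⟨ degIn-toG M x ⟩
      degG M x + sum (map (λ p → M (cutEdge (slot p)) ⊙ inc G x p) atU)
        ≡⟨ cong (degG M x +_) (sum-map-cong (All.map (λ {p} at → cong (M (cutEdge (slot p)) ⊙_) (proj₂ at x x≢u)) dropped-at-u)) ⟩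
      degG M x + sum (map (λ p → M (cutEdge (slot p)) ⊙ δ (_≟_ G) (proj₁ (us (slot p))) x) atU)
        ≡⟨ cong (degG M x +_) (star-sum (λ i → M (cutEdge i) ⊙ δ (_≟_ G) (proj₁ (us i)) x)) ⟩
      degG M x + cutG M x
        ≡⟨ sym (degIn-J-G M (punct G x≢u)) ⟩
      degIn J M (inj₁ (punct G x≢u))
        ≡⟨ perfect (inj₁ (punct G x≢u)) ⟩
      1  ∎

  module ToH (cubicH : Cubic H) (bipH : Bipartite H) (nbH : NeighbourhoodIs H v (proj₁ v₁) (proj₁ v₂) (proj₁ v₃)) where
    open Classify (restrictEdge H v)
    colour : V H → Bool
    colour = proj₁ bipH
    open Balance H cubicH colour (proj₂ bipH)

    toH : (Edge J → Bool) → Edge H → Bool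
    toH M e = [ (λ j → M (hEdge j)) , (λ _ → false) ]′ (classify (edges H) e)

    degIn-toH : ∀ M z → degIn H (toH M) z ≡ degH M z
    degIn-toH M z = begin
      degIn H (toH M) z
        ≡⟨ degIn-∑ H (toH M) z ⟩
      ∑[ e < #E H ] (toH M e ⊙ inc H z (ends H e))
        ≡⟨ ∑-classify (edges H) [ (λ j → M (hEdge j)) , (λ _ → false) ]′
                      (λ p c → c ⊙ inc H z p) (λ q c → c ⊙ inc H z (lift H q))
                      (λ p q c r≡q → cong (λ p′ → c ⊙ inc H z p′) (restrict-kept H v p r≡q)) ⟩
      degH M z + sum (map (λ _ → 0) (dropped (edges H)))
        ≡⟨ cong (degH M z +_) (sum-zeros (dropped (edges H))) ⟩
      degH M z + 0
        ≡⟨ +-identityʳ (degH M z) ⟩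
      degH M z  ∎

    vs-colour : ∀ i → colour (proj₁ (vs i)) ≢ colour v
    vs-colour i with listed-adjacent H (λ i → proj₁ (vs i)) nbH i
    ... | e , _ , inj₁ eq = λ same → proj₂ bipH e (trans (cong (λ p → colour (proj₁ p)) eq)
                                                   (trans (sym same) (cong (λ p → colour (proj₂ p)) (sym eq))))
    ... | e , _ , inj₂ eq = λ same → proj₂ bipH e (trans (cong (λ p → colour (proj₁ p)) eq)
                                                   (trans same (cong (λ p → colour (proj₂ p)) (sym eq))))

    cutH-vanishes : ∀ M z → (∀ i → proj₁ (vs i) ≢ z) → cutH M z ≡ 0
    cutH-vanishes M z z∉vs = trans
      (sum-cong-≗ λ i → cong (λ b → M (cutEdge i) ⊙ ⟦ b ⟧) (dec-false (_≟_ H (proj₁ (vs i)) z) (z∉vs i)))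
      (∑-⊙-zero 3 (λ i → M (cutEdge i)))

    -- seen from H, a perfect matching of J covers every vertex exactly once:
    -- by an edge of H - v, by being v itself, or by a cut edge
    cover-H : ∀ M → IsPerfectMatching J M → ∀ z → degIn H (toH M) z + δ (_≟_ H) v z + cutH M z ≡ 1
    cover-H M perfect z with _≟_ H v z
    ... | yes refl = cong₂ (λ m n → m + 1 + n) (trans (degIn-toH M v) (deleted-at H v (λ j → M (hEdge j))))
                           (cutH-vanishes M v (λ i → punct-≢ H (vs i)))
    ... | no v≢z = begin
      degIn H (toH M) z + 0 + cutH M z  ≡⟨ cong (_+ cutH M z) (trans (+-identityʳ _) (degIn-toH M z)) ⟩
      degH M z + cutH M z               ≡⟨ sym (degIn-J-H M z′) ⟩
      degIn J M (inj₂ z′)               ≡⟨ perfect (inj₂ z′) ⟩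
      1                                 ∎
      where
      z′ : Punct H v
      z′ = punct H (λ z≡v → v≢z (sym z≡v))

    -- the balance of the bipartite graph H forces a single cut edge
    one-cut-edge : ∀ M → IsPerfectMatching J M → ∑[ i < 3 ] ⟦ M (cutEdge i) ⟧ ≡ 1
    one-cut-edge M perfect = *-cancelˡ-≡ _ 1 3 (begin
      3 * ∑[ i < 3 ] ⟦ M (cutEdge i) ⟧
        ≡⟨ sym (endSum-selection H cubicH 3 (λ i → M (cutEdge i)) (λ i → proj₁ (vs i))) ⟩
      endSum H (cutH M)
        ≡⟨ sym (balance (toH M) (colour v) (δ (_≟_ H) v) (cutH M) v-side cut-side (cover-H M perfect)) ⟩
      endSum H (δ (_≟_ H) v)
        ≡⟨ endSum-δ H cubicH v ⟩
      3 * 1  ∎)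
      where
      v-side : ∀ z → colour z ≢ colour v → δ (_≟_ H) v z ≡ 0
      v-side z z∉v with _≟_ H v z
      ... | yes refl = ⊥-elim (z∉v refl)
      ... | no _     = refl
      cut-side : ∀ z → colour z ≡ colour v → cutH M z ≡ 0
      cut-side z z∈v = cutH-vanishes M z (λ i vᵢ≡z → vs-colour i (trans (cong colour vᵢ≡z) z∈v))

multiplicity-transport : (K K′ : Graph) (project : PerfectMatching K → PerfectMatching K′) (partner : Edge K′ → Edge K) →
  (∀ P e → proj₁ (project P) e ≡ proj₁ P (partner e)) →
  ∀ Ms e → multiplicity K′ (map project Ms) e ≡ multiplicity K Ms (partner e)
multiplicity-transport K K′ project partner inherits []       e = refl
multiplicity-transport K K′ project partner inherits (P ∷ Ms) e =
  cong₂ _+_ (cong ⟦_⟧ (inherits P e)) (multiplicity-transport K K′ project partner inherits Ms e)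

proposition6p5 : (G H : Graph) →
    Cubic G → Bridgeless G → ¬ HasOddCovering G →
    Cubic H → Connected H → Bipartite H →
    (u : V G) (u₁ u₂ u₃ : Punct G u) →
    NeighbourhoodIs G u (proj₁ u₁) (proj₁ u₂) (proj₁ u₃) →
    (v : V H) (v₁ v₂ v₃ : Punct H v) →
    NeighbourhoodIs H v (proj₁ v₁) (proj₁ v₂) (proj₁ v₃) →
    ¬ HasOddCovering (join G H u u₁ u₂ u₃ v v₁ v₂ v₃)
proposition6p5 G H cubicG _ no-covering-G cubicH _ bipartiteH u u₁ u₂ u₃ nbG v v₁ v₂ v₃ nbH (Ms , odd) =
  no-covering-G (map project Ms , λ e → subst Odd (sym (transport Ms e)) (odd (partner e)))
  where
  open Join G H u u₁ u₂ u₃ v v₁ v₂ v₃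
  open ToG cubicG nbG
  open ToH cubicH bipartiteH nbH

  project : PerfectMatching J → PerfectMatching G
  project (M , perfect) = toG M , toG-perfect M perfect (one-cut-edge M perfect)

  transport : ∀ Ms e → multiplicity G (map project Ms) e ≡ multiplicity J Ms (partner e)
  transport = multiplicity-transport J G project partner (λ P e → refl)
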